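{- For $n\ge1$ let $B_n=F(0,1,2,\ldots,n-1)$. Then for all $n\ge 1$ and $0\le k\le n$, $$\mathbf{cF}_{n,k}(q)=\mathbf{FT}_{n-k}(B_n,q),\quad \overline{\mathbf{cF}}_{n,k}(q)=\overline{\mathbf{FT}}_{n-k}(B_n,q),$$ $$\mathbf{SF}_{n,k}(q)=\mathbf{RT}_{n-k}(B_n,q),\quad \overline{\mathbf{SF}}_{n,k}(q)=\overline{\mathbf{RT}}_{n-k}(B_n,q).$$
   Context: Fibonacci numbers: $F_0=0$, $F_1=1$, $F_m=F_{m-1}+F_{m-2}$. For any integer $m$, $[m]_q=\frac{1-q^m}{1-q}$. Define, for $k\ge0$ (empty products are 1): $[x]_{\downarrow_{q,F,k}}=\prod_{i=0}^{k-1}[x-F_i]_q$, $\overline{[x]}_{\downarrow_{q,F,k}}=\prod_{i=0}^{k-1}([x]_q-[F_i]_q)$, $[x]_{\uparrow_{q,F,k}}=\prod_{i=0}^{k-1}[x+F_i]_q$, $\overline{[x]}_{\uparrow_{q,F,k}}=\prod_{i=0}^{k-1}([x]_q+[F_i]_q)$. The coefficients $\mathbf{cF}_{n,k}(q),\overline{\mathbf{cF}}_{n,k}(q),\mathbf{SF}_{n,k}(q),\overline{\mathbf{SF}}_{n,k}(q)$ ($0\le k\le n$) are the unique rational functions of $q$ such that for all positive integers $x$: $[x]_{\uparrow_{q,F,n}}=\sum_{k=0}^n\mathbf{cF}_{n,k}(q)[x]_q^k$, $\overline{[x]}_{\uparrow_{q,F,n}}=\sum_{k=0}^n\overline{\mathbf{cF}}_{n,k}(q)[x]_q^k$,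 $[x]_q^n=\sum_{k=0}^n\mathbf{SF}_{n,k}(q)[x]_{\downarrow_{q,F,k}}$, $[x]_q^n=\sum_{k=0}^n\overline{\mathbf{SF}}_{n,k}(q)\overline{[x]}_{\downarrow_{q,F,k}}$. For $m\ge1$, $\mathcal{F}_m$ is the set of tilings of a column of height $m$ (levels $1..m$ from the bottom) by tiles of heights 1 and 2 whose bottom-most tile has height 1; $\mathcal{F}_0=\emptyset$. For $T\in\mathcal{F}_m$, $\mathrm{rank}_m(T)=\sum F_{i-1}$ over all $i$ such that $T$ has a height-2 tile on levels $i-1,i$. For a Ferrers board $B=F(b_1,\dots,b_n)$ (column heights $b_1\le\cdots\le b_n$) and $0\le j\le n$: $\mathcal{FT}_j(B)$ is the set of choices of a set $I$ of $j$ columns with a tiling $T_i\in\mathcal{F}_{b_i}$ for each $i\in I$; $w(P)=q^{\sum_{i\in I}\mathrm{rank}_{b_i}(T_i)+\sum_{j'\notin I}F_{b_{j'}}}$, $\overline{w}(P)=q^{\sum_{i\in I}\mathrm{rank}_{b_i}(T_i)}$; $\mathbf{FT}_j(B,q)=\sum w(P)$, $\overline{\mathbf{FT}}_j(B,q)=\sum\overline{w}(P)$ over $P\in\mathcal{FT}_j(B)$. $\mathcal{NT}_j(B)$ is the set of choices of columns $1\le i_1<\cdots<i_j\le n$ with, for each $s$, a tiling $T_{i_s}\in\mathcal{F}_{e_s}$, $e_s=b_{i_s-s+1}$ (each tiling cancels top cells of later columns so that after $s$ tilings the untiled columns have $b_1,\dots,b_{n-s}$ uncanceled cells); $W(P)=q^{\sum_s\mathrm{rank}_{e_s}(T_{i_s})+\sum_{t=1}^{n-j}F_{b_t}}$,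 $\overline{W}(P)=q^{\sum_s\mathrm{rank}_{e_s}(T_{i_s})}$; $\mathbf{RT}_j(B,q)=\sum W(P)$, $\overline{\mathbf{RT}}_j(B,q)=\sum\overline{W}(P)$ over $P\in\mathcal{NT}_j(B)$. For $j=0$ the only placement is the empty one. -}

module Defs where

open import Data.Nat as ℕ using (ℕ; zero; suc)
open import Data.Integer as ℤ using (ℤ; +_; -[1+_])
open import Data.Rational as ℚ using (ℚ; 0ℚ; 1ℚ; _+_; _*_; _-_; -_; 1/_; _÷_)
open import Data.Rational.Properties as ℚP using (+-assoc; +-inverseˡ; +-identityʳ; +-identityˡ)
open import Data.List using (List; []; _∷_; map; _++_; concatMap; length; filterᵇ; take)
open import Data.Maybe using (Maybe; nothing; just)
open import Data.Bool using (Bool; true; false)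
open import Relation.Binary.PropositionalEquality
open import Relation.Nullary using (¬_)

fib : ℕ → ℕ
fib 0 = 0
fib 1 = 1
fib (suc (suc m)) = fib (suc m) ℕ.+ fib m

_^ℕ_ : ℚ → ℕ → ℚ
q ^ℕ zero = 1ℚ
q ^ℕ suc n = q * (q ^ℕ n)

-- A "generic" value of the parameter q : a rational q with q ≠ 0, q ≠ 1.
-- Rational-function identities in q are stated by evaluation at all such q.

1-q≢0 : (q : ℚ) → q ≢ 1ℚ → (1ℚ - q) ≢ 0ℚ
1-q≢0 q q≢1 e = q≢1 (sym eq)
  where
  eq : 1ℚ ≡ q
  eq = begin
    1ℚ                    ≡⟨ sym (+-identityʳ 1ℚ) ⟩
    1ℚ + 0ℚ               ≡⟨ cong (λ z → 1ℚ + z) (sym (+-inverseˡ q)) ⟩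
    1ℚ + ((- q) + q)      ≡⟨ sym (+-assoc 1ℚ (- q) q) ⟩
    (1ℚ - q) + q          ≡⟨ cong (λ z → z + q) e ⟩
    0ℚ + q                ≡⟨ +-identityˡ q ⟩
    q ∎
    where open ≡-Reasoning

_^ℤ_ : (q : ℚ) → .{{_ : ℚ.NonZero q}} → ℤ → ℚ
q ^ℤ (+ n) = q ^ℕ n
q ^ℤ -[1+ n ] = (1/ q) ^ℕ suc n

qint : (q : ℚ) → q ≢ 0ℚ → q ≢ 1ℚ → ℤ → ℚ
qint q h0 h1 m = (1ℚ - (_^ℤ_ q {{ℚ.≢-nonZero h0}} m)) ÷ (1ℚ - q)
  where instance _ = ℚ.≢-nonZero (1-q≢0 q h1)

sumℚ : List ℚ → ℚ
sumℚ [] = 0ℚ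
sumℚ (a ∷ as) = a + sumℚ as

Σ<_ : ℕ → (ℕ → ℚ) → ℚ
(Σ< zero) f = 0ℚ
(Σ< suc n) f = (Σ< n) f + f n

Π<_ : ℕ → (ℕ → ℚ) → ℚ
(Π< zero) f = 1ℚ
(Π< suc n) f = (Π< n) f * f n

-- Tilings of a column by tiles of height 1 and 2, listed from the bottom.

data Tile : Set where
  one two : Tile

allTilings : ℕ → List (List Tile)
allTilings zero = [] ∷ []
allTilings (suc zero) = (one ∷ []) ∷ []
allTilings (suc (suc m)) =
  map (one ∷_) (allTilings (suc m)) ++ map (two ∷_) (allTilings m)

𝓕 : ℕ → List (List Tile)
𝓕 zero = []
𝓕 (suc m) = map (one ∷_) (allTilings m)

-- rankFrom T s : contribution of the tiles of T, where the first tile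
-- of T starts at level s.  A height-2 tile on levels i-1,i contributes F_{i-1}.
rankFrom : List Tile → ℕ → ℕ
rankFrom [] s = 0
rankFrom (one ∷ t) s = rankFrom t (suc s)
rankFrom (two ∷ t) s = fib s ℕ.+ rankFrom t (suc (suc s))

-- rank_m(T) (levels are numbered 1..m from the bottom)
rank : List Tile → ℕ
rank T = rankFrom T 1

-- Placements: one entry per column; nothing = column not in I,
-- just T = column tiled by T.

Placement : Set
Placement = List (Maybe (List Tile))

numTiled : Placement → ℕ
numTiled [] = 0
numTiled (nothing ∷ p) = numTiled p
numTiled (just _ ∷ p) = suc (numTiled p)

rankSum : Placement → ℕ
rankSum [] = 0
rankSum (nothing ∷ p) = rankSum p
rankSum (just T ∷ p) = rank T ℕ.+ rankSum p

-- 𝓕𝓣(B), all j together: each column i is either untiled or tiled by T ∈ 𝓕_{b_i}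
ftPlacements : List ℕ → List Placement
ftPlacements [] = [] ∷ []
ftPlacements (b ∷ bs) =
  concatMap (λ c → map (c ∷_) (ftPlacements bs))
            (nothing ∷ map just (𝓕 b))

untiledFib : List ℕ → Placement → ℕ
untiledFib [] _ = 0
untiledFib (b ∷ bs) (nothing ∷ p) = fib b ℕ.+ untiledFib bs p
untiledFib (b ∷ bs) (just _ ∷ p) = untiledFib bs p
untiledFib (b ∷ bs) [] = 0

nth : List ℕ → ℕ → ℕ
nth [] _ = 0
nth (b ∷ bs) zero = b
nth (b ∷ bs) (suc i) = nth bs i

-- 𝓝𝓣(B), all j together.  ntPl B u r: placements on the remaining r
-- columns, when u columns have been left untiled so far.  If column i is
-- the s-th tiled column then i - s = u, so e_s = b_{i-s+1} = nth B u
-- (0-indexed).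
ntPl : List ℕ → ℕ → ℕ → List Placement
ntPl B u zero = [] ∷ []
ntPl B u (suc r) =
  map (nothing ∷_) (ntPl B (suc u) r)
  ++ concatMap (λ T → map (just T ∷_) (ntPl B u r)) (𝓕 (nth B u))

ntPlacements : List ℕ → List Placement
ntPlacements B = ntPl B 0 (length B)

sumFib : List ℕ → ℕ
sumFib [] = 0
sumFib (b ∷ bs) = fib b ℕ.+ sumFib bs

withJ : ℕ → List Placement → List Placement
withJ j = filterᵇ (λ P → numTiled P ℕ.≡ᵇ j)

FT : List ℕ → ℕ → ℚ → ℚ
FT B j q = sumℚ (map (λ P → q ^ℕ (rankSum P ℕ.+ untiledFib B P))
                     (withJ j (ftPlacements B)))

FTbar : List ℕ → ℕ → ℚ → ℚ
FTbar B j q = sumℚ (map (λ P → q ^ℕ rankSum P) (withJ j (ftPlacements B)))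

RT : List ℕ → ℕ → ℚ → ℚ
RT B j q = sumℚ (map (λ P → q ^ℕ (rankSum P ℕ.+ sumFib (take (length B ℕ.∸ j) B)))
                     (withJ j (ntPlacements B)))

RTbar : List ℕ → ℕ → ℚ → ℚ
RTbar B j q = sumℚ (map (λ P → q ^ℕ rankSum P) (withJ j (ntPlacements B)))

Bn : ℕ → List ℕ
Bn zero = []
Bn (suc n) = Bn n ++ (n ∷ [])

module _ (q : ℚ) (h0 : q ≢ 0ℚ) (h1 : q ≢ 1ℚ) where

  [_]q : ℤ → ℚ
  [ m ]q = qint q h0 h1 m

  fallF : ℕ → ℤ → ℚ
  fallF k x = (Π< k) (λ i → [ x ℤ.- (+ fib i) ]q)

  fallFbar : ℕ → ℤ → ℚ
  fallFbar k x = (Π< k) (λ i → [ x ]q - [ + fib i ]q)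

  riseF : ℕ → ℤ → ℚ
  riseF k x = (Π< k) (λ i → [ x ℤ.+ (+ fib i) ]q)

  riseFbar : ℕ → ℤ → ℚ
  riseFbar k x = (Π< k) (λ i → [ x ]q + [ + fib i ]q)

  IsCF IsCFbar IsSF IsSFbar : ℕ → (ℕ → ℚ) → Set
  IsCF n c = ∀ (x : ℕ) → 1 ℕ.≤ x →
    riseF n (+ x) ≡ (Σ< suc n) (λ k → c k * ([ + x ]q ^ℕ k))
  IsCFbar n c = ∀ (x : ℕ) → 1 ℕ.≤ x →
    riseFbar n (+ x) ≡ (Σ< suc n) (λ k → c k * ([ + x ]q ^ℕ k))
  IsSF n c = ∀ (x : ℕ) → 1 ℕ.≤ x →
    [ + x ]q ^ℕ n ≡ (Σ< suc n) (λ k → c k * fallF k (+ x))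
  IsSFbar n c = ∀ (x : ℕ) → 1 ℕ.≤ x →
    [ + x ]q ^ℕ n ≡ (Σ< suc n) (λ k → c k * fallFbar k (+ x))

{-# OPTIONS --safe #-}
-- Summing q^rank over the tilings of one column of height b gives [F_b]_q: removing the top tile
-- yields [F_m] = [F_(m-1)] + q^F_(m-1) [F_(m-2)].  In a file placement every column is independently
-- untiled, with weight q^F_b X (resp. X), or tiled, with total weight [F_b]_q, so the placement
-- polynomial factors as ∏_b (q^F_b X + [F_b]_q), which is ∏_b [x + F_b]_q at X = [x]_q
-- (resp. ∏_b ([x]_q + [F_b]_q)).  In a rook placement, with u columns left untiled so far, the next
-- column is either left untiled or tiled at height b_(u+1); hence X^n = Σ_P q^rank(P) V_untiled(P)
-- for every sequence with V_0 = 1 and X V_u = V_(u+1) + [F_b_(u+1)]_q V_u.  Both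
-- V_u = q^(F_b_1 + ⋯ + F_b_u) ∏_(t≤u) [x - F_b_t]_q  (as [x] = q^f [x - f] + [f]) and
-- V_u = ∏_(t≤u) ([x]_q - [F_b_t]_q) qualify.  The coefficient of X^k, resp. V_k, collects the
-- placements with n - k tiled columns.
module Submission where

open import Defs
open import Data.Nat using (ℕ; _≤_; _∸_)
open import Data.Rational using (ℚ; 0ℚ; 1ℚ)
open import Data.Product using (_×_)
open import Relation.Binary.PropositionalEquality using (_≢_)

open import Data.Bool using (Bool; true; false; if_then_else_)
open import Data.Bool.Properties using (if-cong)
open import Data.Integer as ℤ using (ℤ)
import Data.Integer.Properties as ℤ
open import Data.List using (List; []; _∷_; map; _++_; concatMap; length; filterᵇ; take)
open import Data.List.Properties using (map-∘; map-++; map-cong; length-++)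
open import Data.List.Relation.Unary.All as All using (All; []; _∷_)
open import Data.List.Relation.Unary.All.Properties using (map⁺; ++⁺; concat⁺)
open import Data.Maybe using (just; nothing)
open import Data.Nat as ℕ using (zero; suc; _<_; s≤s)
import Data.Nat.Properties as ℕ
open import Data.Product using (_,_)
open import Data.Rational as ℚ using (_+_; _*_; _-_; 1/_)
import Data.Rational.Properties as ℚ
open import Data.Rational.Solver using (module +-*-Solver)
open import Data.Sum using (inj₁; inj₂)
open import Function using (_∘_)
open import Relation.Binary.PropositionalEquality
  using (_≡_; refl; sym; trans; cong; cong₂; subst; module ≡-Reasoning)
open import Relation.Nullary using (yes; no)
open import Relation.Nullary.Decidable using (dec-true; dec-false)

open +-*-Solver
open ≡-Reasoning

sumℚ-++ : (xs ys : List ℚ) → sumℚ (xs ++ ys) ≡ sumℚ xs + sumℚ ys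
sumℚ-++ []       ys = sym (ℚ.+-identityˡ _)
sumℚ-++ (x ∷ xs) ys = trans (cong (x +_) (sumℚ-++ xs ys)) (sym (ℚ.+-assoc x _ _))

module _ {A : Set} where

  sumℚ-map-cong : {f g : A → ℚ} (L : List A) → (∀ a → f a ≡ g a) →
    sumℚ (map f L) ≡ sumℚ (map g L)
  sumℚ-map-cong []      f≡g = refl
  sumℚ-map-cong (a ∷ L) f≡g = cong₂ _+_ (f≡g a) (sumℚ-map-cong L f≡g)

  sumℚ-map-cong-All : {R : A → Set} {f g : A → ℚ} (L : List A) →
    (∀ a → R a → f a ≡ g a) → All R L → sumℚ (map f L) ≡ sumℚ (map g L)
  sumℚ-map-cong-All []      f≡g []       = refl
  sumℚ-map-cong-All (a ∷ L) f≡g (r ∷ rs) = cong₂ _+_ (f≡g a r) (sumℚ-map-cong-All L f≡g rs)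

  sumℚ-map-∘ : {B : Set} (f : B → ℚ) (g : A → B) (L : List A) →
    sumℚ (map f (map g L)) ≡ sumℚ (map (f ∘ g) L)
  sumℚ-map-∘ f g L = cong sumℚ (sym (map-∘ L))

  sumℚ-map-++ : (f : A → ℚ) (xs ys : List A) →
    sumℚ (map f (xs ++ ys)) ≡ sumℚ (map f xs) + sumℚ (map f ys)
  sumℚ-map-++ f xs ys = trans (cong sumℚ (map-++ f xs ys)) (sumℚ-++ (map f xs) (map f ys))

  *-distribˡ-sumℚ : (c : ℚ) (f : A → ℚ) (L : List A) →
    c * sumℚ (map f L) ≡ sumℚ (map (λ a → c * f a) L)
  *-distribˡ-sumℚ c f []      = ℚ.*-zeroʳ c
  *-distribˡ-sumℚ c f (a ∷ L) =
    trans (ℚ.*-distribˡ-+ c (f a) _) (cong (c * f a +_) (*-distribˡ-sumℚ c f L))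

  *-distribʳ-sumℚ : (c : ℚ) (f : A → ℚ) (L : List A) →
    sumℚ (map f L) * c ≡ sumℚ (map (λ a → f a * c) L)
  *-distribʳ-sumℚ c f L = begin
    sumℚ (map f L) * c              ≡⟨ ℚ.*-comm _ c ⟩
    c * sumℚ (map f L)              ≡⟨ *-distribˡ-sumℚ c f L ⟩
    sumℚ (map (λ a → c * f a) L)    ≡⟨ sumℚ-map-cong L (λ a → ℚ.*-comm c (f a)) ⟩
    sumℚ (map (λ a → f a * c) L)    ∎

  sumℚ-filterᵇ-∷ : (p : A → Bool) (f : A → ℚ) (a : A) (L : List A) →
    sumℚ (map f (filterᵇ p (a ∷ L))) ≡ (if p a then f a else 0ℚ) + sumℚ (map f (filterᵇ p L))
  sumℚ-filterᵇ-∷ p f a L with p a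
  ... | true  = refl
  ... | false = sym (ℚ.+-identityˡ _)

sumℚ-concatMap-map : {A B C : Set} (f : B → ℚ) (g : C → A → B) (L : List A) (Cs : List C) →
  sumℚ (map f (concatMap (λ c → map (g c) L) Cs)) ≡ sumℚ (map (λ c → sumℚ (map (f ∘ g c) L)) Cs)
sumℚ-concatMap-map f g L []       = refl
sumℚ-concatMap-map f g L (c ∷ Cs) =
  trans (sumℚ-map-++ f (map (g c) L) _)
        (cong₂ _+_ (sumℚ-map-∘ f (g c) L) (sumℚ-concatMap-map f g L Cs))

prodℚ : List ℚ → ℚ
prodℚ []       = 1ℚ
prodℚ (a ∷ as) = a * prodℚ as

prodℚ-++ : (xs ys : List ℚ) → prodℚ (xs ++ ys) ≡ prodℚ xs * prodℚ ys
prodℚ-++ []       ys = sym (ℚ.*-identityˡ _)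
prodℚ-++ (x ∷ xs) ys = trans (cong (x *_) (prodℚ-++ xs ys)) (sym (ℚ.*-assoc x _ _))

Σ<-cong : ∀ N {f g : ℕ → ℚ} → (∀ k → k < N → f k ≡ g k) → (Σ< N) f ≡ (Σ< N) g
Σ<-cong zero    f≡g = refl
Σ<-cong (suc N) f≡g = cong₂ _+_ (Σ<-cong N (λ k k<N → f≡g k (ℕ.m<n⇒m<1+n k<N))) (f≡g N ℕ.≤-refl)

Π<-cong : ∀ N {f g : ℕ → ℚ} → (∀ k → k < N → f k ≡ g k) → (Π< N) f ≡ (Π< N) g
Π<-cong zero    f≡g = refl
Π<-cong (suc N) f≡g = cong₂ _*_ (Π<-cong N (λ k k<N → f≡g k (ℕ.m<n⇒m<1+n k<N))) (f≡g N ℕ.≤-refl)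

Σ<-0 : ∀ N → (Σ< N) (λ _ → 0ℚ) ≡ 0ℚ
Σ<-0 zero    = refl
Σ<-0 (suc N) = trans (ℚ.+-identityʳ _) (Σ<-0 N)

Σ<-+ : ∀ N (f g : ℕ → ℚ) → (Σ< N) (λ k → f k + g k) ≡ (Σ< N) f + (Σ< N) g
Σ<-+ zero    f g = sym (ℚ.+-identityˡ 0ℚ)
Σ<-+ (suc N) f g = trans (cong (_+ (f N + g N)) (Σ<-+ N f g))
  (solve 4 (λ a b c d → (a :+ b) :+ (c :+ d) := (a :+ c) :+ (b :+ d)) refl
     ((Σ< N) f) ((Σ< N) g) (f N) (g N))

Σ<-δ : ∀ {N m} (g : ℕ → ℚ) → m < N → (Σ< N) (λ k → if k ℕ.≡ᵇ m then g k else 0ℚ) ≡ g m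
Σ<-δ {suc N} {m} g m<1+N with m ℕ.≟ N
... | yes refl = begin
  (Σ< m) δ + (if m ℕ.≡ᵇ m then g m else 0ℚ)
    ≡⟨ cong₂ _+_ (trans (Σ<-cong m δ<m≡0) (Σ<-0 m)) (if-cong (dec-true (m ℕ.≟ m) refl)) ⟩
  0ℚ + g m
    ≡⟨ ℚ.+-identityˡ (g m) ⟩
  g m ∎
  where
  δ : ℕ → ℚ
  δ k = if k ℕ.≡ᵇ m then g k else 0ℚ
  δ<m≡0 : ∀ k → k < m → δ k ≡ 0ℚ
  δ<m≡0 k k<m = if-cong (dec-false (k ℕ.≟ m) (ℕ.<⇒≢ k<m))
... | no m≢N = trans
  (cong₂ _+_ (Σ<-δ g (ℕ.≤∧≢⇒< (ℕ.≤-pred m<1+N) m≢N)) (if-cong (dec-false (N ℕ.≟ m) (m≢N ∘ sym))))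
  (ℚ.+-identityʳ (g m))

≡ᵇ-∸ : ∀ {t u n k} → t ℕ.+ u ≡ n → k ≤ n → (t ℕ.≡ᵇ n ∸ k) ≡ (k ℕ.≡ᵇ u)
≡ᵇ-∸ {t} {u} {n} {k} t+u≡n k≤n with k ℕ.≟ u
... | yes refl = trans (dec-true (t ℕ.≟ n ∸ k) (sym (begin
  n ∸ k       ≡⟨ cong (_∸ k) (sym t+u≡n) ⟩
  t ℕ.+ k ∸ k ≡⟨ ℕ.m+n∸n≡m t k ⟩
  t           ∎))) (sym (dec-true (k ℕ.≟ k) refl))
... | no k≢u = trans (dec-false (t ℕ.≟ n ∸ k) (λ t≡n∸k → k≢u (begin
  k           ≡⟨ ℕ.m∸[m∸n]≡n k≤n ⟨
  n ∸ (n ∸ k) ≡⟨ cong (n ∸_) t≡n∸k ⟨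
  n ∸ t       ≡⟨ cong (_∸ t) t+u≡n ⟨
  t ℕ.+ u ∸ t ≡⟨ ℕ.m+n∸m≡n t u ⟩
  u           ∎))) (sym (dec-false (k ℕ.≟ u) k≢u))

Σ<-if-∸ : ∀ {t u n} (g : ℕ → ℚ) → t ℕ.+ u ≡ n →
  (Σ< suc n) (λ k → if t ℕ.≡ᵇ n ∸ k then g k else 0ℚ) ≡ g u
Σ<-if-∸ {t} {u} {n} g t+u≡n = trans
  (Σ<-cong (suc n) (λ k k<1+n → if-cong (≡ᵇ-∸ t+u≡n (ℕ.≤-pred k<1+n))))
  (Σ<-δ g (s≤s (subst (u ≤_) t+u≡n (ℕ.m≤n+m u t))))

untiledCount : Placement → ℕ
untiledCount []            = 0
untiledCount (nothing ∷ P) = suc (untiledCount P)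
untiledCount (just _ ∷ P)  = untiledCount P

numTiled+untiledCount≡length : ∀ P → numTiled P ℕ.+ untiledCount P ≡ length P
numTiled+untiledCount≡length []            = refl
numTiled+untiledCount≡length (nothing ∷ P) =
  trans (ℕ.+-suc (numTiled P) _) (cong suc (numTiled+untiledCount≡length P))
numTiled+untiledCount≡length (just _ ∷ P)  = cong suc (numTiled+untiledCount≡length P)

untiledCount≤length : ∀ P → untiledCount P ≤ length P
untiledCount≤length P =
  subst (untiledCount P ≤_) (numTiled+untiledCount≡length P) (ℕ.m≤n+m _ (numTiled P))

-- P is counted exactly once, at k = untiledCount P, because numTiled P + untiledCount P = n.
Σ<-sumℚ-withJ : ∀ n (g : Placement → ℕ → ℚ) L → All (λ P → length P ≡ n) L →
  (Σ< suc n) (λ k → sumℚ (map (λ P → g P k) (withJ (n ∸ k) L)))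
    ≡ sumℚ (map (λ P → g P (untiledCount P)) L)
Σ<-sumℚ-withJ n g []      []                = Σ<-0 (suc n)
Σ<-sumℚ-withJ n g (P ∷ L) (length≡n ∷ hL) = begin
  (Σ< suc n) (λ k → sumℚ (map (λ P → g P k) (withJ (n ∸ k) (P ∷ L))))
    ≡⟨ Σ<-cong (suc n) (λ k _ → sumℚ-filterᵇ-∷ (λ P → numTiled P ℕ.≡ᵇ n ∸ k) (λ P → g P k) P L) ⟩
  (Σ< suc n) (λ k → (if numTiled P ℕ.≡ᵇ n ∸ k then g P k else 0ℚ)
                    + sumℚ (map (λ P → g P k) (withJ (n ∸ k) L)))
    ≡⟨ Σ<-+ (suc n) _ _ ⟩
  (Σ< suc n) (λ k → if numTiled P ℕ.≡ᵇ n ∸ k then g P k else 0ℚ)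
    + (Σ< suc n) (λ k → sumℚ (map (λ P → g P k) (withJ (n ∸ k) L)))
    ≡⟨ cong₂ _+_ (Σ<-if-∸ (g P) (trans (numTiled+untiledCount≡length P) length≡n))
                 (Σ<-sumℚ-withJ n g L hL) ⟩
  g P (untiledCount P) + sumℚ (map (λ P → g P (untiledCount P)) L) ∎

Σ<-sumℚ-withJ-* : ∀ n (h : Placement → ℕ → ℚ) (Z : ℕ → ℚ) L → All (λ P → length P ≡ n) L →
  (Σ< suc n) (λ k → sumℚ (map (λ P → h P k) (withJ (n ∸ k) L)) * Z k)
    ≡ sumℚ (map (λ P → h P (untiledCount P) * Z (untiledCount P)) L)
Σ<-sumℚ-withJ-* n h Z L hL = trans
  (Σ<-cong (suc n) (λ k _ → *-distribʳ-sumℚ (Z k) (λ P → h P k) (withJ (n ∸ k) L)))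
  (Σ<-sumℚ-withJ n (λ P k → h P k * Z k) L hL)

All-length-map-∷ : {A : Set} {r : ℕ} {L : List (List A)} (a : A) →
  All (λ P → length P ≡ r) L → All (λ P → length P ≡ suc r) (map (a ∷_) L)
All-length-map-∷ a hL = map⁺ (All.map (cong suc) hL)

ftPlacements-length : ∀ B → All (λ P → length P ≡ length B) (ftPlacements B)
ftPlacements-length []       = refl ∷ []
ftPlacements-length (b ∷ bs) = concat⁺ (map⁺ (All.universal
  (λ c → All-length-map-∷ c (ftPlacements-length bs)) (nothing ∷ map just (𝓕 b))))

ntPl-length : ∀ B u r → All (λ P → length P ≡ r) (ntPl B u r)
ntPl-length B u zero    = refl ∷ []
ntPl-length B u (suc r) = ++⁺
  (All-length-map-∷ nothing (ntPl-length B (suc u) r))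
  (concat⁺ (map⁺ (All.universal
    (λ T → All-length-map-∷ (just T) (ntPl-length B u r)) (𝓕 (nth B u)))))

^ℕ-distribˡ-+-* : (a : ℚ) (m n : ℕ) → a ^ℕ (m ℕ.+ n) ≡ a ^ℕ m * a ^ℕ n
^ℕ-distribˡ-+-* a zero    n = sym (ℚ.*-identityˡ _)
^ℕ-distribˡ-+-* a (suc m) n = trans (cong (a *_) (^ℕ-distribˡ-+-* a m n)) (sym (ℚ.*-assoc a _ _))

^ℕ-inverse : (a : ℚ) .{{_ : ℚ.NonZero a}} (m : ℕ) → a ^ℕ m * (1/ a) ^ℕ m ≡ 1ℚ
^ℕ-inverse a zero    = refl
^ℕ-inverse a (suc m) = begin
  a * a ^ℕ m * (1/ a * (1/ a) ^ℕ m)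
    ≡⟨ solve 4 (λ a x b y → a :* x :* (b :* y) := a :* b :* (x :* y))
         refl a (a ^ℕ m) (1/ a) ((1/ a) ^ℕ m) ⟩
  a * 1/ a * (a ^ℕ m * (1/ a) ^ℕ m)
    ≡⟨ cong₂ _*_ (ℚ.*-inverseʳ a) (^ℕ-inverse a m) ⟩
  1ℚ * 1ℚ
    ≡⟨ ℚ.*-identityˡ 1ℚ ⟩
  1ℚ ∎

untiledProduct : (ℕ → ℚ) → List ℕ → Placement → ℚ
untiledProduct a []       _             = 1ℚ
untiledProduct a (b ∷ bs) []            = 1ℚ
untiledProduct a (b ∷ bs) (nothing ∷ P) = a b * untiledProduct a bs P
untiledProduct a (b ∷ bs) (just _ ∷ P)  = untiledProduct a bs P

untiledProduct-1 : ∀ B P → untiledProduct (λ _ → 1ℚ) B P ≡ 1ℚ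
untiledProduct-1 []       P             = refl
untiledProduct-1 (b ∷ bs) []            = refl
untiledProduct-1 (b ∷ bs) (nothing ∷ P) = trans (ℚ.*-identityˡ _) (untiledProduct-1 bs P)
untiledProduct-1 (b ∷ bs) (just _ ∷ P)  = untiledProduct-1 bs P

sumFib-take-suc : ∀ B u → sumFib (take (suc u) B) ≡ sumFib (take u B) ℕ.+ fib (nth B u)
sumFib-take-suc []       zero    = refl
sumFib-take-suc []       (suc u) = refl
sumFib-take-suc (b ∷ bs) zero    = ℕ.+-comm (fib b) 0
sumFib-take-suc (b ∷ bs) (suc u) =
  trans (cong (fib b ℕ.+_) (sumFib-take-suc bs u)) (sym (ℕ.+-assoc (fib b) _ _))

module _ (q : ℚ) where

  tilingsGF : ℕ → ℕ → ℚ
  tilingsGF m s = sumℚ (map (λ T → q ^ℕ rankFrom T s) (allTilings m))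

  rankGF : ℕ → ℚ
  rankGF b = sumℚ (map (λ T → q ^ℕ rank T) (𝓕 b))

  rankGF-suc : ∀ m → rankGF (suc m) ≡ tilingsGF m 2
  rankGF-suc m = sumℚ-map-∘ (λ T → q ^ℕ rank T) (one ∷_) (allTilings m)

  tilingsGF-bottom : ∀ m s →
    tilingsGF (suc (suc m)) s ≡ tilingsGF (suc m) (suc s) + q ^ℕ fib s * tilingsGF m (suc (suc s))
  tilingsGF-bottom m s = begin
    sumℚ (map w (map (one ∷_) (allTilings (suc m)) ++ map (two ∷_) (allTilings m)))
      ≡⟨ sumℚ-map-++ w (map (one ∷_) (allTilings (suc m))) _ ⟩
    sumℚ (map w (map (one ∷_) (allTilings (suc m)))) + sumℚ (map w (map (two ∷_) (allTilings m)))
      ≡⟨ cong₂ _+_ (sumℚ-map-∘ w (one ∷_) (allTilings (suc m)))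
                   (sumℚ-map-∘ w (two ∷_) (allTilings m)) ⟩
    tilingsGF (suc m) (suc s) + sumℚ (map (λ T → q ^ℕ (fib s ℕ.+ rankFrom T (suc (suc s)))) (allTilings m))
      ≡⟨ cong (tilingsGF (suc m) (suc s) +_)
              (sumℚ-map-cong (allTilings m) (λ T → ^ℕ-distribˡ-+-* q (fib s) _)) ⟩
    tilingsGF (suc m) (suc s) + sumℚ (map (λ T → q ^ℕ fib s * q ^ℕ rankFrom T (suc (suc s))) (allTilings m))
      ≡⟨ cong (tilingsGF (suc m) (suc s) +_) (*-distribˡ-sumℚ (q ^ℕ fib s) _ (allTilings m)) ⟨
    tilingsGF (suc m) (suc s) + q ^ℕ fib s * tilingsGF m (suc (suc s)) ∎
    where
    w : List Tile → ℚ
    w T = q ^ℕ rankFrom T s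

  -- Removing the top tile instead of the bottom one: a continuant obeys both recursions.
  tilingsGF-top : ∀ m s →
    tilingsGF (suc (suc m)) s ≡ tilingsGF (suc m) s + q ^ℕ fib (m ℕ.+ s) * tilingsGF m s
  tilingsGF-top zero          s = tilingsGF-bottom 0 s
  tilingsGF-top (suc zero)    s = begin
    tilingsGF 3 s                                   ≡⟨ tilingsGF-bottom 1 s ⟩
    tilingsGF 2 (suc s) + a * E                     ≡⟨ cong (_+ a * E) (tilingsGF-bottom 0 (suc s)) ⟩
    (E + d * E) + a * E
      ≡⟨ solve 3 (λ e a d → (e :+ d :* e) :+ a :* e := (e :+ a :* e) :+ d :* e) refl E a d ⟩
    (E + a * E) + d * E                             ≡⟨ cong (_+ d * E) (tilingsGF-bottom 0 s) ⟨
    tilingsGF 2 s + d * E                           ∎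
    where
    E a d : ℚ
    E = tilingsGF 0 s
    a = q ^ℕ fib s
    d = q ^ℕ fib (suc s)
  tilingsGF-top (suc (suc m)) s = begin
    G (4 ℕ.+ m) s
      ≡⟨ tilingsGF-bottom (suc (suc m)) s ⟩
    G (3 ℕ.+ m) (suc s) + a * G (2 ℕ.+ m) (2 ℕ.+ s)
      ≡⟨ cong₂ (λ u v → u + a * v) (trans (tilingsGF-top (suc m) (suc s)) shift₁)
                                   (trans (tilingsGF-top m (2 ℕ.+ s)) shift₂) ⟩
    (A + d * B) + a * (C + d * D)
      ≡⟨ solve 6 (λ A B C D a d → (A :+ d :* B) :+ a :* (C :+ d :* D) := (A :+ a :* C) :+ d :* (B :+ a :* D))
           refl A B C D a d ⟩
    (A + a * C) + d * (B + a * D)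
      ≡⟨ cong₂ (λ u v → u + d * v) (tilingsGF-bottom (suc m) s) (tilingsGF-bottom m s) ⟨
    G (3 ℕ.+ m) s + d * G (2 ℕ.+ m) s ∎
    where
    G : ℕ → ℕ → ℚ
    G = tilingsGF
    A B C D a d : ℚ
    A = G (2 ℕ.+ m) (suc s)
    B = G (suc m) (suc s)
    C = G (suc m) (2 ℕ.+ s)
    D = G m (2 ℕ.+ s)
    a = q ^ℕ fib s
    d = q ^ℕ fib (2 ℕ.+ (m ℕ.+ s))
    shift₁ : A + q ^ℕ fib (suc m ℕ.+ suc s) * B ≡ A + d * B
    shift₁ = cong (λ i → A + q ^ℕ fib i * B) (cong suc (ℕ.+-suc m s))
    shift₂ : C + q ^ℕ fib (m ℕ.+ (2 ℕ.+ s)) * D ≡ C + d * D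
    shift₂ = cong (λ i → C + q ^ℕ fib i * D) (trans (ℕ.+-suc m (suc s)) (cong suc (ℕ.+-suc m s)))

  untiledProduct-fib : ∀ B P → untiledProduct (λ b → q ^ℕ fib b) B P ≡ q ^ℕ untiledFib B P
  untiledProduct-fib []       P             = refl
  untiledProduct-fib (b ∷ bs) []            = refl
  untiledProduct-fib (b ∷ bs) (nothing ∷ P) =
    trans (cong (q ^ℕ fib b *_) (untiledProduct-fib bs P)) (sym (^ℕ-distribˡ-+-* q (fib b) _))
  untiledProduct-fib (b ∷ bs) (just _ ∷ P)  = untiledProduct-fib bs P

  sumℚ-tiledColumn : ∀ b (g : Placement → ℚ) (L : List Placement) →
    sumℚ (map (λ T → sumℚ (map (λ P → q ^ℕ rankSum (just T ∷ P) * g P) L)) (𝓕 b))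
      ≡ rankGF b * sumℚ (map (λ P → q ^ℕ rankSum P * g P) L)
  sumℚ-tiledColumn b g L = begin
    sumℚ (map (λ T → sumℚ (map (λ P → q ^ℕ (rank T ℕ.+ rankSum P) * g P) L)) (𝓕 b))
      ≡⟨ sumℚ-map-cong (𝓕 b) (λ T → trans (sumℚ-map-cong L (λ P → factor T P))
                                         (sym (*-distribˡ-sumℚ (q ^ℕ rank T) _ L))) ⟩
    sumℚ (map (λ T → q ^ℕ rank T * S) (𝓕 b))
      ≡⟨ *-distribʳ-sumℚ S (λ T → q ^ℕ rank T) (𝓕 b) ⟨
    rankGF b * S ∎
    where
    S : ℚ
    S = sumℚ (map (λ P → q ^ℕ rankSum P * g P) L)
    factor : ∀ T P → q ^ℕ (rank T ℕ.+ rankSum P) * g P ≡ q ^ℕ rank T * (q ^ℕ rankSum P * g P)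
    factor T P =
      trans (cong (_* g P) (^ℕ-distribˡ-+-* q (rank T) (rankSum P))) (ℚ.*-assoc (q ^ℕ rank T) _ (g P))

  ftPlacements-GF : (a : ℕ → ℚ) (Y : ℚ) (B : List ℕ) →
    sumℚ (map (λ P → q ^ℕ rankSum P * (untiledProduct a B P * Y ^ℕ untiledCount P)) (ftPlacements B))
      ≡ prodℚ (map (λ b → a b * Y + rankGF b) B)
  ftPlacements-GF a Y []       = trans (ℚ.+-identityʳ _) (ℚ.*-identityˡ _)
  ftPlacements-GF a Y (b ∷ bs) = begin
    sumℚ (map f (ftPlacements (b ∷ bs)))
      ≡⟨ sumℚ-concatMap-map f _∷_ L (nothing ∷ map just (𝓕 b)) ⟩
    sumℚ (map (λ P → f (nothing ∷ P)) L)
      + sumℚ (map (λ c → sumℚ (map (λ P → f (c ∷ P)) L)) (map just (𝓕 b)))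
      ≡⟨ cong₂ _+_ untiled (trans (sumℚ-map-∘ _ just (𝓕 b)) (sumℚ-tiledColumn b g L)) ⟩
    a b * Y * S + rankGF b * S
      ≡⟨ ℚ.*-distribʳ-+ S (a b * Y) (rankGF b) ⟨
    (a b * Y + rankGF b) * S
      ≡⟨ cong ((a b * Y + rankGF b) *_) (ftPlacements-GF a Y bs) ⟩
    prodℚ (map (λ b → a b * Y + rankGF b) (b ∷ bs)) ∎
    where
    L : List Placement
    L = ftPlacements bs
    f g : Placement → ℚ
    f P = q ^ℕ rankSum P * (untiledProduct a (b ∷ bs) P * Y ^ℕ untiledCount P)
    g P = untiledProduct a bs P * Y ^ℕ untiledCount P
    S : ℚ
    S = sumℚ (map (λ P → q ^ℕ rankSum P * g P) L)
    untiled : sumℚ (map (λ P → f (nothing ∷ P)) L) ≡ a b * Y * S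
    untiled = trans
      (sumℚ-map-cong L (λ P →
         solve 5 (λ r ab u y y' → r :* (ab :* u :* (y :* y')) := ab :* y :* (r :* (u :* y'))) refl
           (q ^ℕ rankSum P) (a b) (untiledProduct a bs P) Y (Y ^ℕ untiledCount P)))
      (sym (*-distribˡ-sumℚ (a b * Y) _ L))

  sumℚ-ntPl-suc : (B : List ℕ) (V : ℕ → ℚ) (r u : ℕ) →
    sumℚ (map (λ P → q ^ℕ rankSum P * V (u ℕ.+ untiledCount P)) (ntPl B u (suc r)))
      ≡ sumℚ (map (λ P → q ^ℕ rankSum P * V (suc u ℕ.+ untiledCount P)) (ntPl B (suc u) r))
        + rankGF (nth B u) * sumℚ (map (λ P → q ^ℕ rankSum P * V (u ℕ.+ untiledCount P)) (ntPl B u r))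
  sumℚ-ntPl-suc B V r u = begin
    sumℚ (map f (map (nothing ∷_) L₁ ++ concatMap (λ T → map (just T ∷_) L) (𝓕 (nth B u))))
      ≡⟨ sumℚ-map-++ f (map (nothing ∷_) L₁) _ ⟩
    sumℚ (map f (map (nothing ∷_) L₁))
      + sumℚ (map f (concatMap (λ T → map (just T ∷_) L) (𝓕 (nth B u))))
      ≡⟨ cong₂ _+_ (trans (sumℚ-map-∘ f (nothing ∷_) L₁) (sumℚ-map-cong L₁ shift))
                   (trans (sumℚ-concatMap-map f (λ T → just T ∷_) L (𝓕 (nth B u)))
                          (sumℚ-tiledColumn (nth B u) (λ P → V (u ℕ.+ untiledCount P)) L)) ⟩
    sumℚ (map (λ P → q ^ℕ rankSum P * V (suc u ℕ.+ untiledCount P)) L₁)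
      + rankGF (nth B u) * sumℚ (map f L) ∎
    where
    L L₁ : List Placement
    L  = ntPl B u r
    L₁ = ntPl B (suc u) r
    f : Placement → ℚ
    f P = q ^ℕ rankSum P * V (u ℕ.+ untiledCount P)
    shift : ∀ P → f (nothing ∷ P) ≡ q ^ℕ rankSum P * V (suc u ℕ.+ untiledCount P)
    shift P = cong (λ i → q ^ℕ rankSum P * V i) (ℕ.+-suc u _)

  ntPl-GF : (B : List ℕ) (X : ℚ) (V : ℕ → ℚ) →
    (∀ u → X * V u ≡ V (suc u) + rankGF (nth B u) * V u) →
    ∀ r u → X ^ℕ r * V u ≡ sumℚ (map (λ P → q ^ℕ rankSum P * V (u ℕ.+ untiledCount P)) (ntPl B u r))
  ntPl-GF B X V step zero    u =
    trans (cong (λ i → 1ℚ * V i) (sym (ℕ.+-identityʳ u))) (sym (ℚ.+-identityʳ _))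
  ntPl-GF B X V step (suc r) u = begin
    X * X ^ℕ r * V u
      ≡⟨ solve 3 (λ x y v → x :* y :* v := y :* (x :* v)) refl X (X ^ℕ r) (V u) ⟩
    X ^ℕ r * (X * V u)
      ≡⟨ cong (X ^ℕ r *_) (step u) ⟩
    X ^ℕ r * (V (suc u) + c * V u)
      ≡⟨ solve 4 (λ y a c b → y :* (a :+ c :* b) := y :* a :+ c :* (y :* b))
           refl (X ^ℕ r) (V (suc u)) c (V u) ⟩
    X ^ℕ r * V (suc u) + c * (X ^ℕ r * V u)
      ≡⟨ cong₂ (λ s t → s + c * t) (ntPl-GF B X V step r (suc u)) (ntPl-GF B X V step r u) ⟩
    sumℚ (map (λ P → q ^ℕ rankSum P * V (suc u ℕ.+ untiledCount P)) (ntPl B (suc u) r))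
      + c * sumℚ (map (λ P → q ^ℕ rankSum P * V (u ℕ.+ untiledCount P)) (ntPl B u r))
      ≡⟨ sumℚ-ntPl-suc B V r u ⟨
    sumℚ (map (λ P → q ^ℕ rankSum P * V (u ℕ.+ untiledCount P)) (ntPl B u (suc r))) ∎
    where
    c : ℚ
    c = rankGF (nth B u)

  FT-expansion : ∀ {n} B → length B ≡ n → (X : ℚ) →
    (Σ< suc n) (λ k → FT B (n ∸ k) q * X ^ℕ k) ≡ prodℚ (map (λ b → q ^ℕ fib b * X + rankGF b) B)
  FT-expansion {n} B length≡n X = begin
    (Σ< suc n) (λ k → FT B (n ∸ k) q * X ^ℕ k)
      ≡⟨ Σ<-sumℚ-withJ-* n (λ P _ → q ^ℕ (rankSum P ℕ.+ untiledFib B P)) (X ^ℕ_) (ftPlacements B) hL ⟩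
    sumℚ (map (λ P → q ^ℕ (rankSum P ℕ.+ untiledFib B P) * X ^ℕ untiledCount P) (ftPlacements B))
      ≡⟨ sumℚ-map-cong (ftPlacements B) split ⟩
    sumℚ (map (λ P → q ^ℕ rankSum P * (untiledProduct (λ b → q ^ℕ fib b) B P * X ^ℕ untiledCount P))
              (ftPlacements B))
      ≡⟨ ftPlacements-GF (λ b → q ^ℕ fib b) X B ⟩
    prodℚ (map (λ b → q ^ℕ fib b * X + rankGF b) B) ∎
    where
    hL : All (λ P → length P ≡ n) (ftPlacements B)
    hL = All.map (λ e → trans e length≡n) (ftPlacements-length B)
    split : ∀ P → q ^ℕ (rankSum P ℕ.+ untiledFib B P) * X ^ℕ untiledCount P
                ≡ q ^ℕ rankSum P * (untiledProduct (λ b → q ^ℕ fib b) B P * X ^ℕ untiledCount P)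
    split P = begin
      q ^ℕ (rankSum P ℕ.+ untiledFib B P) * X ^ℕ untiledCount P
        ≡⟨ cong (_* X ^ℕ untiledCount P) (^ℕ-distribˡ-+-* q (rankSum P) _) ⟩
      q ^ℕ rankSum P * q ^ℕ untiledFib B P * X ^ℕ untiledCount P
        ≡⟨ ℚ.*-assoc (q ^ℕ rankSum P) _ _ ⟩
      q ^ℕ rankSum P * (q ^ℕ untiledFib B P * X ^ℕ untiledCount P)
        ≡⟨ cong (λ z → q ^ℕ rankSum P * (z * X ^ℕ untiledCount P)) (untiledProduct-fib B P) ⟨
      q ^ℕ rankSum P * (untiledProduct (λ b → q ^ℕ fib b) B P * X ^ℕ untiledCount P) ∎

  FTbar-expansion : ∀ {n} B → length B ≡ n → (X : ℚ) →
    (Σ< suc n) (λ k → FTbar B (n ∸ k) q * X ^ℕ k) ≡ prodℚ (map (λ b → X + rankGF b) B)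
  FTbar-expansion {n} B length≡n X = begin
    (Σ< suc n) (λ k → FTbar B (n ∸ k) q * X ^ℕ k)
      ≡⟨ Σ<-sumℚ-withJ-* n (λ P _ → q ^ℕ rankSum P) (X ^ℕ_) (ftPlacements B) hL ⟩
    sumℚ (map (λ P → q ^ℕ rankSum P * X ^ℕ untiledCount P) (ftPlacements B))
      ≡⟨ sumℚ-map-cong (ftPlacements B) (λ P → cong (q ^ℕ rankSum P *_)
           (trans (sym (ℚ.*-identityˡ _)) (cong (_* X ^ℕ untiledCount P) (sym (untiledProduct-1 B P))))) ⟩
    sumℚ (map (λ P → q ^ℕ rankSum P * (untiledProduct (λ _ → 1ℚ) B P * X ^ℕ untiledCount P))
              (ftPlacements B))
      ≡⟨ ftPlacements-GF (λ _ → 1ℚ) X B ⟩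
    prodℚ (map (λ b → 1ℚ * X + rankGF b) B)
      ≡⟨ cong prodℚ (map-cong (λ b → cong (_+ rankGF b) (ℚ.*-identityˡ X)) B) ⟩
    prodℚ (map (λ b → X + rankGF b) B) ∎
    where
    hL : All (λ P → length P ≡ n) (ftPlacements B)
    hL = All.map (λ e → trans e length≡n) (ftPlacements-length B)

  RT-expansion : ∀ {n} B → length B ≡ n → (X : ℚ) (y : ℕ → ℚ) →
    (∀ u → X ≡ q ^ℕ fib (nth B u) * y u + rankGF (nth B u)) →
    X ^ℕ n ≡ (Σ< suc n) (λ k → RT B (n ∸ k) q * (Π< k) y)
  RT-expansion B refl X y X≡ = begin
    X ^ℕ n                  ≡⟨ solve 1 (λ z → z := z :* (con 1ℚ :* con 1ℚ)) refl (X ^ℕ n) ⟩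
    X ^ℕ n * V 0            ≡⟨ ntPl-GF B X V step n 0 ⟩
    sumℚ (map (λ P → q ^ℕ rankSum P * V (untiledCount P)) (ntPlacements B))
      ≡⟨ sumℚ-map-cong-All (ntPlacements B) merge (ntPl-length B 0 n) ⟩
    sumℚ (map (λ P → h P (untiledCount P) * (Π< untiledCount P) y) (ntPlacements B))
      ≡⟨ Σ<-sumℚ-withJ-* n h (λ k → (Π< k) y) (ntPlacements B) (ntPl-length B 0 n) ⟨
    (Σ< suc n) (λ k → RT B (n ∸ k) q * (Π< k) y) ∎
    where
    n : ℕ
    n = length B
    V : ℕ → ℚ
    V u = q ^ℕ sumFib (take u B) * (Π< u) y
    h : Placement → ℕ → ℚ
    h P k = q ^ℕ (rankSum P ℕ.+ sumFib (take (n ∸ (n ∸ k)) B))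
    step : ∀ u → X * V u ≡ V (suc u) + rankGF (nth B u) * V u
    step u = begin
      X * (s * Φ)                         ≡⟨ cong (_* (s * Φ)) (X≡ u) ⟩
      (a * y u + c) * (s * Φ)
        ≡⟨ solve 5 (λ a y c s φ → (a :* y :+ c) :* (s :* φ) := s :* a :* (φ :* y) :+ c :* (s :* φ))
             refl a (y u) c s Φ ⟩
      s * a * (Φ * y u) + c * (s * Φ)
        ≡⟨ cong (λ z → z * (Φ * y u) + c * (s * Φ))
             (trans (sym (^ℕ-distribˡ-+-* q (sumFib (take u B)) (fib (nth B u))))
                    (cong (q ^ℕ_) (sym (sumFib-take-suc B u)))) ⟩
      V (suc u) + c * V u ∎
      where
      s Φ a c : ℚ
      s = q ^ℕ sumFib (take u B)
      Φ = (Π< u) y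
      a = q ^ℕ fib (nth B u)
      c = rankGF (nth B u)
    merge : ∀ P → length P ≡ n →
      q ^ℕ rankSum P * V (untiledCount P) ≡ h P (untiledCount P) * (Π< untiledCount P) y
    merge P length≡n = begin
      q ^ℕ rankSum P * (q ^ℕ sumFib (take u B) * (Π< u) y)
        ≡⟨ ℚ.*-assoc (q ^ℕ rankSum P) _ _ ⟨
      q ^ℕ rankSum P * q ^ℕ sumFib (take u B) * (Π< u) y
        ≡⟨ cong (_* (Π< u) y) (^ℕ-distribˡ-+-* q (rankSum P) _) ⟨
      q ^ℕ (rankSum P ℕ.+ sumFib (take u B)) * (Π< u) y
        ≡⟨ cong (λ i → q ^ℕ (rankSum P ℕ.+ sumFib (take i B)) * (Π< u) y)
             (sym (ℕ.m∸[m∸n]≡n (subst (u ≤_) length≡n (untiledCount≤length P)))) ⟩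
      h P u * (Π< u) y ∎
      where
      u : ℕ
      u = untiledCount P

  RTbar-expansion : ∀ {n} B → length B ≡ n → (X : ℚ) →
    X ^ℕ n ≡ (Σ< suc n) (λ k → RTbar B (n ∸ k) q * (Π< k) (λ t → X - rankGF (nth B t)))
  RTbar-expansion B refl X = begin
    X ^ℕ n                  ≡⟨ ℚ.*-identityʳ (X ^ℕ n) ⟨
    X ^ℕ n * Ψ 0            ≡⟨ ntPl-GF B X Ψ step n 0 ⟩
    sumℚ (map (λ P → q ^ℕ rankSum P * Ψ (untiledCount P)) (ntPlacements B))
      ≡⟨ Σ<-sumℚ-withJ-* n (λ P _ → q ^ℕ rankSum P) Ψ (ntPlacements B) (ntPl-length B 0 n) ⟨
    (Σ< suc n) (λ k → RTbar B (n ∸ k) q * Ψ k) ∎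
    where
    n : ℕ
    n = length B
    Ψ : ℕ → ℚ
    Ψ u = (Π< u) (λ t → X - rankGF (nth B t))
    step : ∀ u → X * Ψ u ≡ Ψ (suc u) + rankGF (nth B u) * Ψ u
    step u = solve 3 (λ x c ψ → x :* ψ := ψ :* (x :- c) :+ c :* ψ) refl X (rankGF (nth B u)) (Ψ u)

length-Bn : ∀ n → length (Bn n) ≡ n
length-Bn zero    = refl
length-Bn (suc n) = trans (length-++ (Bn n)) (trans (ℕ.+-comm (length (Bn n)) 1) (cong suc (length-Bn n)))

nth-++ˡ : ∀ xs ys {t} → t < length xs → nth (xs ++ ys) t ≡ nth xs t
nth-++ˡ (x ∷ xs) ys {zero}  _           = refl
nth-++ˡ (x ∷ xs) ys {suc t} (s≤s t<len) = nth-++ˡ xs ys t<len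

nth-++-length : ∀ xs y ys → nth (xs ++ y ∷ ys) (length xs) ≡ y
nth-++-length []       y ys = refl
nth-++-length (x ∷ xs) y ys = nth-++-length xs y ys

nth-Bn : ∀ n {t} → t < n → nth (Bn n) t ≡ t
nth-Bn (suc n) {t} t<1+n with ℕ.m<1+n⇒m<n∨m≡n t<1+n
... | inj₁ t<n  = trans (nth-++ˡ (Bn n) _ (subst (t <_) (sym (length-Bn n)) t<n)) (nth-Bn n t<n)
... | inj₂ refl = trans (cong (nth (Bn n ++ t ∷ [])) (sym (length-Bn n))) (nth-++-length (Bn n) t [])

Π<-nth-Bn : ∀ n {k} (f : ℕ → ℚ) → k ≤ n → (Π< k) (f ∘ nth (Bn n)) ≡ (Π< k) f
Π<-nth-Bn n f k≤n = Π<-cong _ (λ t t<k → cong f (nth-Bn n (ℕ.<-≤-trans t<k k≤n)))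

prodℚ-map-Bn : ∀ n (f : ℕ → ℚ) → prodℚ (map f (Bn n)) ≡ (Π< n) f
prodℚ-map-Bn zero    f = refl
prodℚ-map-Bn (suc n) f = begin
  prodℚ (map f (Bn n ++ n ∷ []))               ≡⟨ cong prodℚ (map-++ f (Bn n) (n ∷ [])) ⟩
  prodℚ (map f (Bn n) ++ f n ∷ [])             ≡⟨ prodℚ-++ (map f (Bn n)) (f n ∷ []) ⟩
  prodℚ (map f (Bn n)) * (f n * 1ℚ)            ≡⟨ cong₂ _*_ (prodℚ-map-Bn n f) (ℚ.*-identityʳ (f n)) ⟩
  (Π< n) f * f n                               ∎

module _ (q : ℚ) (q≢0 : q ≢ 0ℚ) (q≢1 : q ≢ 1ℚ) where

  private
    instance
      q-nonZero : ℚ.NonZero q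
      q-nonZero = ℚ.≢-nonZero q≢0
      1-q-nonZero : ℚ.NonZero (1ℚ - q)
      1-q-nonZero = ℚ.≢-nonZero (1-q≢0 q q≢1)

    [_] : ℤ → ℚ
    [_] = [_]q q q≢0 q≢1

    w : ℚ
    w = 1/ (1ℚ - q)

  [0]≡0 : [ ℤ.+ 0 ] ≡ 0ℚ
  [0]≡0 = solve 1 (λ w → (con 1ℚ :- con 1ℚ) :* w := con 0ℚ) refl w

  [1]≡1 : [ ℤ.+ 1 ] ≡ 1ℚ
  [1]≡1 = trans (solve 2 (λ q w → (con 1ℚ :- q :* con 1ℚ) :* w := (con 1ℚ :- q) :* w) refl q w)
                (ℚ.*-inverseʳ (1ℚ - q))

  [a+b]≡[a]+qᵃ[b] : ∀ a b → [ ℤ.+ (a ℕ.+ b) ] ≡ [ ℤ.+ a ] + q ^ℕ a * [ ℤ.+ b ]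
  [a+b]≡[a]+qᵃ[b] a b = begin
    (1ℚ - q ^ℕ (a ℕ.+ b)) * w              ≡⟨ cong (λ z → (1ℚ - z) * w) (^ℕ-distribˡ-+-* q a b) ⟩
    (1ℚ - q ^ℕ a * q ^ℕ b) * w
      ≡⟨ solve 3 (λ x y w → (con 1ℚ :- x :* y) :* w := (con 1ℚ :- x) :* w :+ x :* ((con 1ℚ :- y) :* w))
           refl (q ^ℕ a) (q ^ℕ b) w ⟩
    (1ℚ - q ^ℕ a) * w + q ^ℕ a * ((1ℚ - q ^ℕ b) * w) ∎

  qᶠqˣ⁻ᶠ≡qˣ : ∀ x f → q ^ℕ f * q ^ℤ (ℤ.+ x ℤ.- ℤ.+ f) ≡ q ^ℕ x
  qᶠqˣ⁻ᶠ≡qˣ x       zero    = trans (ℚ.*-identityˡ _) (cong (q ^ℕ_) (ℕ.+-identityʳ x))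
  qᶠqˣ⁻ᶠ≡qˣ zero    (suc f) = ^ℕ-inverse q (suc f)
  qᶠqˣ⁻ᶠ≡qˣ (suc x) (suc f) = begin
    q * q ^ℕ f * q ^ℤ (ℤ.+ suc x ℤ.- ℤ.+ suc f)   ≡⟨ cong (λ z → q * q ^ℕ f * q ^ℤ z) x-f-shift ⟩
    q * q ^ℕ f * q ^ℤ (ℤ.+ x ℤ.- ℤ.+ f)           ≡⟨ ℚ.*-assoc q _ _ ⟩
    q * (q ^ℕ f * q ^ℤ (ℤ.+ x ℤ.- ℤ.+ f))         ≡⟨ cong (q *_) (qᶠqˣ⁻ᶠ≡qˣ x f) ⟩
    q * q ^ℕ x                                    ∎
    where
    x-f-shift : ℤ.+ suc x ℤ.- ℤ.+ suc f ≡ ℤ.+ x ℤ.- ℤ.+ f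
    x-f-shift = trans (ℤ.m-n≡m⊖n (suc x) (suc f))
                      (trans (ℤ.[1+m]⊖[1+n]≡m⊖n x f) (sym (ℤ.m-n≡m⊖n x f)))

  [x]≡qᶠ[x-f]+[f] : ∀ x f → [ ℤ.+ x ] ≡ q ^ℕ f * [ ℤ.+ x ℤ.- ℤ.+ f ] + [ ℤ.+ f ]
  [x]≡qᶠ[x-f]+[f] x f = sym (begin
    q ^ℕ f * ((1ℚ - p) * w) + (1ℚ - q ^ℕ f) * w
      ≡⟨ solve 3 (λ a p w → a :* ((con 1ℚ :- p) :* w) :+ (con 1ℚ :- a) :* w := (con 1ℚ :- a :* p) :* w)
           refl (q ^ℕ f) p w ⟩
    (1ℚ - q ^ℕ f * p) * w   ≡⟨ cong (λ z → (1ℚ - z) * w) (qᶠqˣ⁻ᶠ≡qˣ x f) ⟩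
    (1ℚ - q ^ℕ x) * w       ∎)
    where
    p : ℚ
    p = q ^ℤ (ℤ.+ x ℤ.- ℤ.+ f)

  tilingsGF-fib : ∀ m → tilingsGF q m 2 ≡ [ ℤ.+ fib (suc m) ]
  tilingsGF-fib zero          = trans (ℚ.+-identityʳ 1ℚ) (sym [1]≡1)
  tilingsGF-fib (suc zero)    = trans (ℚ.+-identityʳ 1ℚ) (sym [1]≡1)
  tilingsGF-fib (suc (suc m)) = begin
    tilingsGF q (suc (suc m)) 2
      ≡⟨ tilingsGF-top q m 2 ⟩
    tilingsGF q (suc m) 2 + q ^ℕ fib (m ℕ.+ 2) * tilingsGF q m 2
      ≡⟨ cong₂ (λ i z → tilingsGF q (suc m) 2 + q ^ℕ fib i * z) (ℕ.+-comm m 2) (tilingsGF-fib m) ⟩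
    tilingsGF q (suc m) 2 + q ^ℕ fib (2 ℕ.+ m) * [ ℤ.+ fib (suc m) ]
      ≡⟨ cong (_+ q ^ℕ fib (2 ℕ.+ m) * [ ℤ.+ fib (suc m) ]) (tilingsGF-fib (suc m)) ⟩
    [ ℤ.+ fib (2 ℕ.+ m) ] + q ^ℕ fib (2 ℕ.+ m) * [ ℤ.+ fib (suc m) ]
      ≡⟨ [a+b]≡[a]+qᵃ[b] (fib (2 ℕ.+ m)) (fib (suc m)) ⟨
    [ ℤ.+ fib (3 ℕ.+ m) ] ∎

  rankGF-fib : ∀ b → rankGF q b ≡ [ ℤ.+ fib b ]
  rankGF-fib zero    = sym [0]≡0
  rankGF-fib (suc m) = trans (rankGF-suc q m) (tilingsGF-fib m)

  module _ (n : ℕ) where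

    cF-Bn : IsCF q q≢0 q≢1 n (λ k → FT (Bn n) (n ∸ k) q)
    cF-Bn x _ = sym (begin
      (Σ< suc n) (λ k → FT (Bn n) (n ∸ k) q * X ^ℕ k)
        ≡⟨ FT-expansion q (Bn n) (length-Bn n) X ⟩
      prodℚ (map (λ i → q ^ℕ fib i * X + rankGF q i) (Bn n))
        ≡⟨ prodℚ-map-Bn n _ ⟩
      (Π< n) (λ i → q ^ℕ fib i * X + rankGF q i)
        ≡⟨ Π<-cong n (λ i _ → rising i) ⟩
      riseF q q≢0 q≢1 n (ℤ.+ x) ∎)
      where
      X : ℚ
      X = [ ℤ.+ x ]
      rising : ∀ i → q ^ℕ fib i * X + rankGF q i ≡ [ ℤ.+ (x ℕ.+ fib i) ]
      rising i = begin
        q ^ℕ fib i * X + rankGF q i        ≡⟨ cong (q ^ℕ fib i * X +_) (rankGF-fib i) ⟩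
        q ^ℕ fib i * X + [ ℤ.+ fib i ]     ≡⟨ ℚ.+-comm (q ^ℕ fib i * X) _ ⟩
        [ ℤ.+ fib i ] + q ^ℕ fib i * X     ≡⟨ [a+b]≡[a]+qᵃ[b] (fib i) x ⟨
        [ ℤ.+ (fib i ℕ.+ x) ]              ≡⟨ cong (λ m → [ ℤ.+ m ]) (ℕ.+-comm (fib i) x) ⟩
        [ ℤ.+ (x ℕ.+ fib i) ]              ∎

    cFbar-Bn : IsCFbar q q≢0 q≢1 n (λ k → FTbar (Bn n) (n ∸ k) q)
    cFbar-Bn x _ = sym (begin
      (Σ< suc n) (λ k → FTbar (Bn n) (n ∸ k) q * X ^ℕ k)
        ≡⟨ FTbar-expansion q (Bn n) (length-Bn n) X ⟩
      prodℚ (map (λ i → X + rankGF q i) (Bn n))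
        ≡⟨ prodℚ-map-Bn n _ ⟩
      (Π< n) (λ i → X + rankGF q i)
        ≡⟨ Π<-cong n (λ i _ → cong (X +_) (rankGF-fib i)) ⟩
      riseFbar q q≢0 q≢1 n (ℤ.+ x) ∎)
      where
      X : ℚ
      X = [ ℤ.+ x ]

    SF-Bn : IsSF q q≢0 q≢1 n (λ k → RT (Bn n) (n ∸ k) q)
    SF-Bn x _ = begin
      X ^ℕ n
        ≡⟨ RT-expansion q (Bn n) (length-Bn n) X (falling ∘ nth (Bn n)) (split ∘ nth (Bn n)) ⟩
      (Σ< suc n) (λ k → RT (Bn n) (n ∸ k) q * (Π< k) (falling ∘ nth (Bn n)))
        ≡⟨ Σ<-cong (suc n) (λ k k<1+n →
             cong (RT (Bn n) (n ∸ k) q *_) (Π<-nth-Bn n falling (ℕ.≤-pred k<1+n))) ⟩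
      (Σ< suc n) (λ k → RT (Bn n) (n ∸ k) q * fallF q q≢0 q≢1 k (ℤ.+ x)) ∎
      where
      X : ℚ
      X = [ ℤ.+ x ]
      falling : ℕ → ℚ
      falling i = [ ℤ.+ x ℤ.- ℤ.+ fib i ]
      split : ∀ b → X ≡ q ^ℕ fib b * falling b + rankGF q b
      split b = trans ([x]≡qᶠ[x-f]+[f] x (fib b)) (cong (q ^ℕ fib b * falling b +_) (sym (rankGF-fib b)))

    SFbar-Bn : IsSFbar q q≢0 q≢1 n (λ k → RTbar (Bn n) (n ∸ k) q)
    SFbar-Bn x _ = begin
      X ^ℕ n
        ≡⟨ RTbar-expansion q (Bn n) (length-Bn n) X ⟩
      (Σ< suc n) (λ k → RTbar (Bn n) (n ∸ k) q * (Π< k) (falling ∘ nth (Bn n)))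
        ≡⟨ Σ<-cong (suc n) (λ k k<1+n →
             cong (RTbar (Bn n) (n ∸ k) q *_) (fallingFactorial k (ℕ.≤-pred k<1+n))) ⟩
      (Σ< suc n) (λ k → RTbar (Bn n) (n ∸ k) q * fallFbar q q≢0 q≢1 k (ℤ.+ x)) ∎
      where
      X : ℚ
      X = [ ℤ.+ x ]
      falling : ℕ → ℚ
      falling i = X - rankGF q i
      fallingFactorial : ∀ k → k ≤ n → (Π< k) (falling ∘ nth (Bn n)) ≡ fallFbar q q≢0 q≢1 k (ℤ.+ x)
      fallingFactorial k k≤n =
        trans (Π<-nth-Bn n falling k≤n) (Π<-cong k (λ i _ → cong (X -_) (rankGF-fib i)))

mainTheorem6 : (n : ℕ) → 1 ≤ n → (q : ℚ) → (h0 : q ≢ 0ℚ) → (h1 : q ≢ 1ℚ) →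
    IsCF q h0 h1 n (λ k → FT (Bn n) (n ∸ k) q)
    × IsCFbar q h0 h1 n (λ k → FTbar (Bn n) (n ∸ k) q)
    × IsSF q h0 h1 n (λ k → RT (Bn n) (n ∸ k) q)
    × IsSFbar q h0 h1 n (λ k → RTbar (Bn n) (n ∸ k) q)
mainTheorem6 n _ q h0 h1 = cF-Bn q h0 h1 n , cFbar-Bn q h0 h1 n , SF-Bn q h0 h1 n , SFbar-Bn q h0 h1 n
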